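{- Let $\mathcal{F}$ be the free non-symmetric operad on two binary generators $\alpha,\beta$, and let $\pi:\mathcal{F}\to\mathrm{CNCB}$ be the operad morphism with $\pi(\alpha)=\tau_{aab}$ and $\pi(\beta)=\tau_{abb}$. Then $\pi$ induces an isomorphism from $\mathcal{F}/_{\equiv}$ onto the suboperad $\langle\tau_{aab},\tau_{abb}\rangle$, where $\equiv$ is the smallest operad congruence of $\mathcal{F}$ containing $(\beta\circ_2\alpha)\circ_2\beta\equiv(\beta\circ_1\beta)\circ_2\alpha$ and $(\alpha\circ_2\alpha)\circ_2\beta\equiv(\alpha\circ_1\beta)\circ_2\alpha$.
   Context: A bicoloured noncrossing configuration (BNC) of size $n\ge2$ is a regular polygon with vertices $1,\dots,n+1$ (clockwise) with each arc $(i,j)$, $1\le i<j\le n+1$, coloured blue, red or uncoloured, such that no two coloured (blue or red) arcs cross and red arcs are diagonals. The edges are $(i,i+1)$ for $i\in[n]$ (the $i$-th edge), the base is $(1,n+1)$, and the other arcs are diagonals. There is also a unique BNC of size $1$, a single blue arc (its edge and base). $\mathrm{CNCB}$ is the non-symmetric operad of BNCs (arity = size, unit = the size-$1$ BNC) with composition $\mathfrak{C}\circ_i\mathfrak{D}$ ($\mathfrak{C}$ of size $n$, $\mathfrak{D}$ of size $m$) obtained by gluing the base of $\mathfrak{D}$ onto the $i$-th edge of $\mathfrak{C}$. Vertex $j$ of $\mathfrak{C}$ goes to $j$ if $j\le i$ and to $j+m-1$ otherwise, and vertex $\ell$ of $\mathfrak{D}$ goes to $i+\ell-1$. All other arcs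 keep their colours. The arc $(i,i+m)$ is red if the $i$-th edge of $\mathfrak{C}$ and the base of $\mathfrak{D}$ are both uncoloured, blue if both are blue, and uncoloured otherwise. All remaining arcs are uncoloured. For $x,y,z\in\{a,b\}$, $\tau_{xyz}$ is the BNC of size $2$ (a triangle, which has no diagonals) whose first edge $(1,2)$, base $(1,3)$ and second edge $(2,3)$ are respectively coloured $x,y,z$, where $a$ means blue and $b$ means uncoloured. $\langle G\rangle$ denotes the smallest suboperad of $\mathrm{CNCB}$ containing $G$. -}

module Defs where

open import Data.Nat using (ℕ; zero; suc; _+_; _∸_; _≤_; _<_; _≤ᵇ_; _<ᵇ_; _≡ᵇ_)
open import Data.Bool using (Bool; true; false; if_then_else_; _∧_; _∨_)
open import Data.Sum using (_⊎_)
open import Data.Empty using (⊥)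
open import Data.Product using (_×_)
open import Relation.Binary.PropositionalEquality using (_≡_)

data Colour : Set where
  blue red none : Colour

-- A configuration of size n: vertices 1 .. n+1, and for 1 ≤ i < j ≤ n+1
-- the colour  col i j  of the arc (i,j).  Values outside that range are
-- irrelevant (see _≈_).
record Config : Set where
  constructor mkConfig
  field
    size : ℕ
    col  : ℕ → ℕ → Colour
open Config public

_≈_ : Config → Config → Set
C ≈ D = (size C ≡ size D) ×
        (∀ i j → 1 ≤ i → i < j → j ≤ suc (size C) → col C i j ≡ col D i j)

data Coloured : Colour → Set where
  c-blue : Coloured blue
  c-red  : Coloured red

Arc : ℕ → ℕ → ℕ → Set
Arc n i j = (1 ≤ i) × (i < j) × (j ≤ suc n)

IsSide : ℕ → ℕ → ℕ → Set
IsSide n i j = (suc i ≡ j) ⊎ ((i ≡ 1) × (j ≡ suc n))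

data IsBNC (C : Config) : Set where
  isBNC :
    (∀ i j k l → Arc (size C) i j → Arc (size C) k l →
       Coloured (col C i j) → Coloured (col C k l) →
       i < k → k < j → j < l → ⊥) →
    (∀ i j → Arc (size C) i j → col C i j ≡ red →
       IsSide (size C) i j → ⊥) →
    IsBNC C

unitC : Config
unitC = mkConfig 1 (λ i j → if (i ≡ᵇ 1) ∧ (j ≡ᵇ 2) then blue else none)

glue : Colour → Colour → Colour
glue none none = red
glue blue blue = blue
glue _    _    = none

inI : ℕ → ℕ → ℕ → Bool
inI a b p = (a ≤ᵇ p) ∧ (p ≤ᵇ b)

-- C ∘_i D  (intended for 1 ≤ i ≤ size C); result has size n + m - 1.
-- Vertex j of C goes to j (j ≤ i) or j+m-1 (j > i);
-- vertex ℓ of D goes to i+ℓ-1.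
compose : Config → ℕ → Config → Config
compose C i D = mkConfig (n + m ∸ 1) c
  where
  n = size C
  m = size D
  backC : ℕ → ℕ
  backC p = if p ≤ᵇ i then p else p ∸ (m ∸ 1)
  backD : ℕ → ℕ
  backD p = suc (p ∸ i)
  inC : ℕ → Bool
  inC p = inI 1 i p ∨ inI (i + m) (n + m) p
  c : ℕ → ℕ → Colour
  c p q =
    if (p ≡ᵇ i) ∧ (q ≡ᵇ i + m)
    then glue (col C i (suc i)) (col D 1 (suc m))
    else if inI i (i + m) p ∧ inI i (i + m) q
    then col D (backD p) (backD q)
    else if inC p ∧ inC q
    then col C (backC p) (backC q)
    else none

data AB : Set where
  a b : AB

abCol : AB → Colour
abCol a = blue
abCol b = none

τ : AB → AB → AB → Config
τ x y z = mkConfig 2 c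
  where
  c : ℕ → ℕ → Colour
  c 1 2 = abCol x
  c 1 3 = abCol y
  c 2 3 = abCol z
  c _ _ = none

τaab τabb : Config
τaab = τ a a b
τabb = τ a b b

data InGen : Config → Set where
  gen-unit : InGen unitC
  gen-aab  : InGen τaab
  gen-abb  : InGen τabb
  gen-comp : ∀ {C D} i → 1 ≤ i → i ≤ size C →
             InGen C → InGen D → InGen (compose C i D)

data Gen : Set where
  α β : Gen

data Tree : Set where
  leaf : Tree
  node : Gen → Tree → Tree → Tree

arity : Tree → ℕ
arity leaf = 1
arity (node _ l r) = arity l + arity r

g : Gen → Tree
g x = node x leaf leaf

infixl 20 _∘[_]_
_∘[_]_ : Tree → ℕ → Tree → Tree
leaf ∘[ i ] t = t
node x l r ∘[ i ] t =
  if i ≤ᵇ arity l then node x (l ∘[ i ] t) r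
  else node x l (r ∘[ i ∸ arity l ] t)

data _≡F_ : Tree → Tree → Set where
  ≡F-refl  : ∀ {s} → s ≡F s
  ≡F-sym   : ∀ {s t} → s ≡F t → t ≡F s
  ≡F-trans : ∀ {s t u} → s ≡F t → t ≡F u → s ≡F u
  ≡F-comp  : ∀ {s s' t t'} i → 1 ≤ i → i ≤ arity s →
             s ≡F s' → t ≡F t' → (s ∘[ i ] t) ≡F (s' ∘[ i ] t')
  ≡F-rel1  : ((g β ∘[ 2 ] g α) ∘[ 2 ] g β) ≡F ((g β ∘[ 1 ] g β) ∘[ 2 ] g α)
  ≡F-rel2  : ((g α ∘[ 2 ] g α) ∘[ 2 ] g β) ≡F ((g α ∘[ 1 ] g β) ∘[ 2 ] g α)

πgen : Gen → Config
πgen α = τaab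
πgen β = τabb

-- node x l r = (x ∘_2 r) ∘_1 l in F
π : Tree → Config
π leaf = unitC
π (node x l r) = compose (compose (πgen x) 2 (π r)) 1 (π l)

-- π t can be computed on the tree itself: an arc of π t is coloured exactly when it is
-- spanned by a subtree, and its colour is read off from the generator at the root of that
-- subtree and from whether the subtree is the whole tree, a left child or a right child.
-- Under this description partial composition in CNCB is grafting of trees, which gives at
-- once that π lands in ⟨τaab, τabb⟩, that every element of ⟨τaab, τabb⟩ is some π t, and that
-- π respects ≡ (the two relations are checked by computation).
-- Conversely, let s = node x l r and t have the same colouring, and v = arity l.  The arcs
-- of s around vertex v (none crosses v, none ending at v is blue, none starting at v is red,
-- the edge after v is blue) force t, up to the rotation
--   y(T₁, α(β(T₂, T₃), T₄)) ≡ y(β(T₁, α(T₂, T₃)), T₄),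
-- whose instances with T₁ … T₄ leaves are the two relations, into a tree y(A, C) with
-- arity A = v; then y = x, and induction on s finishes.

module Submission where

open import Defs
open import Data.Product using (_×_; Σ; _,_; proj₁; proj₂)
open import Function.Bundles using (_⇔_; mk⇔)
open import Function.Base using (_∘′_)
open import Data.Nat using (ℕ; zero; suc; _+_; _∸_; _≤_; _<_; _≤ᵇ_; _≡ᵇ_; z≤n; s≤s; _≟_; _≤?_)
open import Data.Nat.Properties
open import Data.Nat.Tactic.RingSolver using (solve-∀)
open import Data.Bool using (Bool; true; false; if_then_else_; _∧_; _∨_; T)
open import Data.Bool.Properties using (∧-zeroʳ; ∨-zeroʳ)
open import Data.Sum using (_⊎_; inj₁; inj₂)
open import Data.Empty using (⊥; ⊥-elim)
open import Data.Unit using (tt)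
open import Relation.Nullary using (¬_; yes; no; _×-dec_)
open import Relation.Binary.PropositionalEquality
open import Relation.Binary using (Setoid; tri<; tri≈; tri>)
import Relation.Binary.Reasoning.Setoid as SetoidReasoning
open import Level using (0ℓ)

≤⇒≤ᵇ≡true : ∀ {m n} → m ≤ n → (m ≤ᵇ n) ≡ true
≤⇒≤ᵇ≡true {m} {n} h with m ≤ᵇ n | ≤⇒≤ᵇ {m} {n} h
... | true | _ = refl

>⇒≤ᵇ≡false : ∀ {m n} → n < m → (m ≤ᵇ n) ≡ false
>⇒≤ᵇ≡false {m} {n} h with m ≤ᵇ n in eq
... | false = refl
... | true = ⊥-elim (<⇒≱ h (≤ᵇ⇒≤ m n (subst T (sym eq) tt)))

≡⇒≡ᵇ≡true : ∀ {m n} → m ≡ n → (m ≡ᵇ n) ≡ true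
≡⇒≡ᵇ≡true {m} {n} h with m ≡ᵇ n | ≡⇒≡ᵇ m n h
... | true | _ = refl

≢⇒≡ᵇ≡false : ∀ {m n} → m ≢ n → (m ≡ᵇ n) ≡ false
≢⇒≡ᵇ≡false {m} {n} h with m ≡ᵇ n in eq
... | false = refl
... | true = ⊥-elim (h (≡ᵇ⇒≡ m n (subst T (sym eq) tt)))

∧≡true⇒both : ∀ {x y} → (x ∧ y) ≡ true → (x ≡ true) × (y ≡ true)
∧≡true⇒both {true} {true} _ = refl , refl

≡ᵇ∧≡ᵇ≡false : ∀ {k l m n} → ¬ (k ≡ l × m ≡ n) → ((k ≡ᵇ l) ∧ (m ≡ᵇ n)) ≡ false
≡ᵇ∧≡ᵇ≡false {k} {l} {m} {n} ne with k ≟ l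
... | no k≢l rewrite ≢⇒≡ᵇ≡false k≢l = refl
... | yes k≡l rewrite ≡⇒≡ᵇ≡true k≡l | ≢⇒≡ᵇ≡false {m} {n} (λ m≡n → ne (k≡l , m≡n)) = refl

1≤arity : ∀ t → 1 ≤ arity t
1≤arity leaf = s≤s z≤n
1≤arity (node _ l r) = ≤-trans (1≤arity l) (m≤m+n (arity l) (arity r))

2≤arity-node : ∀ x l r → 2 ≤ arity (node x l r)
2≤arity-node x l r = +-mono-≤ (1≤arity l) (1≤arity r)

-- the number of leaves a tree adds when it is grafted on a leaf
excess : Tree → ℕ
excess t = arity t ∸ 1

arity≡1+excess : ∀ t → arity t ≡ suc (excess t)
arity≡1+excess t = sym (m+[n∸m]≡n (1≤arity t))

-- The colouring of π t, computed directly on the tree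

-- A subtree is the whole tree, a left child or a right child.  The arc it
-- spans is the glue of its own base with the first edge (blue) or the
-- second edge (uncoloured) of its parent's triangle, so its colour depends
-- on that place.
data Place : Set where
  top left right : Place

leafColour : Place → Colour
leafColour top   = blue
leafColour left  = blue
leafColour right = none

nodeColour : Gen → Place → Colour
nodeColour α top   = blue
nodeColour α left  = blue
nodeColour α right = none
nodeColour β top   = none
nodeColour β left  = none
nodeColour β right = red

rootColour : Tree → Place → Colour
rootColour leaf = leafColour
rootColour (node x _ _) = nodeColour x

-- Vertices are numbered 0 .. arity t from the left, so the root spans (0, arity t).
arcColour : Tree → Place → ℕ → ℕ → Colour
arcColour leaf place p q = if (p ≡ᵇ 0) ∧ (q ≡ᵇ 1) then leafColour place else none
arcColour (node x l r) place p q =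
  if (p ≡ᵇ 0) ∧ (q ≡ᵇ (arity l + arity r)) then nodeColour x place
  else if q ≤ᵇ arity l then arcColour l left p q
  else if arity l ≤ᵇ p then arcColour r right (p ∸ arity l) (q ∸ arity l)
  else none

arcColour-root : ∀ t place → arcColour t place 0 (arity t) ≡ rootColour t place
arcColour-root leaf place = refl
arcColour-root (node x l r) place rewrite ≡⇒≡ᵇ≡true (refl {x = arity l + arity r}) = refl

arcColour-root′ : ∀ t place {N} → N ≡ arity t → arcColour t place 0 N ≡ rootColour t place
arcColour-root′ t place refl = arcColour-root t place

arcColour-left : ∀ x l r place p q → q ≤ arity l →
                 arcColour (node x l r) place p q ≡ arcColour l left p q
arcColour-left x l r place p q h
  rewrite ≡ᵇ∧≡ᵇ≡false {p} {0} (λ (_ , q≡N) → <⇒≢ (≤-<-trans h (m<m+n (arity l) (1≤arity r))) q≡N)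
        | ≤⇒≤ᵇ≡true h = refl

arcColour-right : ∀ x l r place p q → p < q →
                  arcColour (node x l r) place (arity l + p) (arity l + q) ≡ arcColour r right p q
arcColour-right x l r place p q h
  rewrite ≡ᵇ∧≡ᵇ≡false {arity l + p} {0} {arity l + q} {arity l + arity r}
            (λ (e , _) → <⇒≢ (≤-trans (1≤arity l) (m≤m+n (arity l) p)) (sym e))
        | >⇒≤ᵇ≡false {arity l + q} {arity l} (m<m+n (arity l) (≤-<-trans z≤n h))
        | ≤⇒≤ᵇ≡true (m≤m+n (arity l) p)
        | m+n∸m≡n (arity l) p | m+n∸m≡n (arity l) q = refl

arcColour-right′ : ∀ x l r place p q {P Q} → p < q → P ≡ arity l + p → Q ≡ arity l + q →
                   arcColour (node x l r) place P Q ≡ arcColour r right p q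
arcColour-right′ x l r place p q h refl refl = arcColour-right x l r place p q h

arcColour-cross : ∀ x l r place p q → p < arity l → arity l < q →
                  (0 < p ⊎ q < arity l + arity r) → arcColour (node x l r) place p q ≡ none
arcColour-cross x l r place p q h1 h2 (inj₁ h3)
  rewrite ≡ᵇ∧≡ᵇ≡false {p} {0} {q} {arity l + arity r} (λ (e , _) → <⇒≢ h3 (sym e))
        | >⇒≤ᵇ≡false h2 | >⇒≤ᵇ≡false h1 = refl
arcColour-cross x l r place p q h1 h2 (inj₂ h3)
  rewrite ≡ᵇ∧≡ᵇ≡false {p} {0} {q} {arity l + arity r} (λ (_ , e) → <⇒≢ h3 e)
        | >⇒≤ᵇ≡false h2 | >⇒≤ᵇ≡false h1 = refl

arcColour-place : ∀ t place place′ p q → ¬ (p ≡ 0 × q ≡ arity t) → p < q → q ≤ arity t →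
                  arcColour t place p q ≡ arcColour t place′ p q
arcColour-place leaf _ _ zero (suc zero) ne _ _ = ⊥-elim (ne (refl , refl))
arcColour-place leaf _ _ zero (suc (suc q)) _ _ (s≤s ())
arcColour-place leaf _ _ (suc p) (suc zero) _ (s≤s ()) _
arcColour-place leaf _ _ (suc p) (suc (suc q)) _ _ (s≤s ())
arcColour-place (node x l r) place place′ p q ne _ _ rewrite ≡ᵇ∧≡ᵇ≡false ne = refl

glue-leafColour : ∀ place t → glue (leafColour place) (rootColour t top) ≡ rootColour t place
glue-leafColour top leaf = refl
glue-leafColour top (node α _ _) = refl
glue-leafColour top (node β _ _) = refl
glue-leafColour left leaf = refl
glue-leafColour left (node α _ _) = refl
glue-leafColour left (node β _ _) = refl
glue-leafColour right leaf = refl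
glue-leafColour right (node α _ _) = refl
glue-leafColour right (node β _ _) = refl

-- leaves are numbered from 1, as in  _∘[_]_
leafPlace : Tree → ℕ → Place → Place
leafPlace leaf i place = place
leafPlace (node x l r) i place =
  if i ≤ᵇ arity l then leafPlace l i left else leafPlace r (i ∸ arity l) right

private
  m<1+[m+n] : ∀ m n → m < suc (m + n)
  m<1+[m+n] m n = s≤s (m≤m+n m n)

  1+[m+n]∸m≡1+n : ∀ m n → suc (m + n) ∸ m ≡ suc n
  1+[m+n]∸m≡1+n m n = trans (cong (_∸ m) (sym (+-suc m n))) (m+n∸m≡n m (suc n))

m+n+o≡m+o+n : ∀ m n o → m + n + o ≡ m + o + n
m+n+o≡m+o+n = solve-∀

data LeafSide (l : Tree) : ℕ → Set where
  inLeft  : ∀ {c} → suc c ≤ arity l → LeafSide l c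
  inRight : ∀ c → LeafSide l (arity l + c)

leafSide : ∀ l c → LeafSide l c
leafSide l c with suc c ≤? arity l
... | yes h = inLeft h
... | no h with m≤n⇒∃[o]m+o≡n (≤-pred (≰⇒> h))
...   | c′ , refl = inRight c′

∘-left : ∀ x l r t c → suc c ≤ arity l → node x l r ∘[ suc c ] t ≡ node x (l ∘[ suc c ] t) r
∘-left x l r t c h rewrite ≤⇒≤ᵇ≡true h = refl

∘-right : ∀ x l r t c′ → node x l r ∘[ suc (arity l + c′) ] t ≡ node x l (r ∘[ suc c′ ] t)
∘-right x l r t c′ rewrite >⇒≤ᵇ≡false (m<1+[m+n] (arity l) c′) | 1+[m+n]∸m≡1+n (arity l) c′ = refl

leafPlace-left : ∀ x l r c place → suc c ≤ arity l → leafPlace (node x l r) (suc c) place ≡ leafPlace l (suc c) left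
leafPlace-left x l r c place h rewrite ≤⇒≤ᵇ≡true h = refl

leafPlace-right : ∀ x l r c′ place → leafPlace (node x l r) (suc (arity l + c′)) place ≡ leafPlace r (suc c′) right
leafPlace-right x l r c′ place rewrite >⇒≤ᵇ≡false (m<1+[m+n] (arity l) c′) | 1+[m+n]∸m≡1+n (arity l) c′ = refl

arity-∘ : ∀ s t c → suc c ≤ arity s → arity (s ∘[ suc c ] t) ≡ arity s + excess t
arity-∘ leaf t zero _ = arity≡1+excess t
arity-∘ leaf t (suc c) (s≤s ())
arity-∘ (node x l r) t c c<s with leafSide l c
... | inLeft c<l rewrite ∘-left x l r t c c<l | arity-∘ l t c c<l =
  m+n+o≡m+o+n (arity l) (excess t) (arity r)
... | inRight c′ rewrite ∘-right x l r t c′ | arity-∘ r t c′ (+-cancelˡ-< _ _ _ c<s) =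
  sym (+-assoc (arity l) (arity r) (excess t))

c+arity≡1+c+excess : ∀ c t → c + arity t ≡ suc c + excess t
c+arity≡1+c+excess c t = trans (cong (c +_) (arity≡1+excess t)) (+-suc c (excess t))

module _ (l t : Tree) {c : ℕ} (c<l : suc c ≤ arity l) where
  arity≤arity-∘ : arity l ≤ arity (l ∘[ suc c ] t)
  arity≤arity-∘ = subst (arity l ≤_) (sym (arity-∘ l t c c<l)) (m≤m+n (arity l) (excess t))

  ≤arity⇒≤arity-∘ : ∀ {q} → q ≤ arity l → q + excess t ≤ arity (l ∘[ suc c ] t)
  ≤arity⇒≤arity-∘ h = subst (_ ≤_) (sym (arity-∘ l t c c<l)) (+-monoˡ-≤ (excess t) h)

  <arity⇒<arity-∘ : ∀ {q} → q < arity l → q + excess t < arity (l ∘[ suc c ] t)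
  <arity⇒<arity-∘ h = subst (_ <_) (sym (arity-∘ l t c c<l)) (+-monoˡ-< (excess t) h)

  >arity⇒>arity-∘ : ∀ {q} → arity l < q → arity (l ∘[ suc c ] t) < q + excess t
  >arity⇒>arity-∘ h = subst (_< _) (sym (arity-∘ l t c c<l)) (+-monoˡ-< (excess t) h)

arcColour-∘-inner : ∀ s t place c i j → suc c ≤ arity s → i < j → j ≤ arity t →
                    arcColour (s ∘[ suc c ] t) place (c + i) (c + j) ≡ arcColour t (leafPlace s (suc c) place) i j
arcColour-∘-inner leaf t place zero i j _ _ _ = refl
arcColour-∘-inner leaf t place (suc c) i j (s≤s ()) _ _
arcColour-∘-inner (node x l r) t place c i j c<s i<j j≤t with leafSide l c
... | inLeft c<l rewrite ∘-left x l r t c c<l | leafPlace-left x l r c place c<l =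
  trans (arcColour-left x (l ∘[ suc c ] t) r place _ _ c+j≤)
        (arcColour-∘-inner l t left c i j c<l i<j j≤t)
  where
  c+j≤ : c + j ≤ arity (l ∘[ suc c ] t)
  c+j≤ = ≤-trans (+-monoʳ-≤ c j≤t)
           (≤-trans (≤-reflexive (c+arity≡1+c+excess c t)) (≤arity⇒≤arity-∘ l t c<l c<l))
... | inRight c′ rewrite ∘-right x l r t c′ | leafPlace-right x l r c′ place =
  trans (arcColour-right′ x l (r ∘[ suc c′ ] t) place (c′ + i) (c′ + j) (+-monoʳ-< c′ i<j)
           (+-assoc (arity l) c′ i) (+-assoc (arity l) c′ j))
        (arcColour-∘-inner r t right c′ i j (+-cancelˡ-< _ _ _ c<s) i<j j≤t)

arcColour-∘-before : ∀ s t place c p q → suc c ≤ arity s → p < q → q ≤ c →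
                     arcColour (s ∘[ suc c ] t) place p q ≡ arcColour s place p q
arcColour-∘-before leaf t place zero p q _ p<q q≤c = ⊥-elim (<⇒≱ p<q (≤-trans q≤c z≤n))
arcColour-∘-before leaf t place (suc c) p q (s≤s ()) _ _
arcColour-∘-before (node x l r) t place c p q c<s p<q q≤c with leafSide l c
... | inLeft c<l rewrite ∘-left x l r t c c<l =
  trans (arcColour-left x (l ∘[ suc c ] t) r place p q (≤-trans q≤l (arity≤arity-∘ l t c<l)))
    (trans (arcColour-∘-before l t left c p q c<l p<q q≤c) (sym (arcColour-left x l r place p q q≤l)))
  where
  q≤l : q ≤ arity l
  q≤l = ≤-trans q≤c (≤-trans (n≤1+n c) c<l)
... | inRight c′ rewrite ∘-right x l r t c′ with q ≤? arity l
...   | yes q≤l =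
  trans (arcColour-left x l (r ∘[ suc c′ ] t) place p q q≤l) (sym (arcColour-left x l r place p q q≤l))
...   | no q≰l with arity l ≤? p
...     | yes l≤p with m≤n⇒∃[o]m+o≡n l≤p | m≤n⇒∃[o]m+o≡n (≤-trans l≤p (<⇒≤ p<q))
...       | p′ , refl | q′ , refl =
  trans (arcColour-right x l (r ∘[ suc c′ ] t) place p′ q′ p′<q′)
    (trans (arcColour-∘-before r t right c′ p′ q′ (+-cancelˡ-< _ _ _ c<s) p′<q′ (+-cancelˡ-≤ (arity l) _ _ q≤c))
      (sym (arcColour-right x l r place p′ q′ p′<q′)))
  where
  p′<q′ : p′ < q′
  p′<q′ = +-cancelˡ-< (arity l) _ _ p<q
arcColour-∘-before (node x l r) t place c p q c<s p<q q≤c | inRight c′ | no q≰l | no l≰p =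
  trans (arcColour-cross x l (r ∘[ suc c′ ] t) place p q (≰⇒> l≰p) (≰⇒> q≰l) (inj₂ (<-≤-trans q<N N≤)))
        (sym (arcColour-cross x l r place p q (≰⇒> l≰p) (≰⇒> q≰l) (inj₂ q<N)))
  where
  q<N : q < arity l + arity r
  q<N = ≤-<-trans q≤c (+-monoʳ-< (arity l) (+-cancelˡ-< _ _ _ c<s))
  N≤ : arity l + arity r ≤ arity l + arity (r ∘[ suc c′ ] t)
  N≤ = +-monoʳ-≤ (arity l) (arity≤arity-∘ r t (+-cancelˡ-< _ _ _ c<s))

2+m≤n≤1⇒⊥ : ∀ {m n} → suc (suc m) ≤ n → n ≤ 1 → ⊥
2+m≤n≤1⇒⊥ h1 h2 with ≤-trans h1 h2
... | s≤s ()

rootColour-∘ : ∀ x l r t i place → rootColour (node x l r ∘[ i ] t) place ≡ nodeColour x place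
rootColour-∘ x l r t i place with i ≤ᵇ arity l
... | true = refl
... | false = refl

nonRoot-+ : ∀ {p q N N′} d → N + d ≡ N′ → 0 < p ⊎ q < N → 0 < p ⊎ q + d < N′
nonRoot-+ d e (inj₁ h) = inj₁ h
nonRoot-+ d refl (inj₂ h) = inj₂ (+-monoˡ-< d h)

arcColour-∘-after : ∀ s t place c p q → suc c ≤ p → p < q → q ≤ arity s →
                    arcColour (s ∘[ suc c ] t) place (p + excess t) (q + excess t) ≡ arcColour s place p q
arcColour-∘-after leaf t place c p q c<p p<q q≤s = ⊥-elim (2+m≤n≤1⇒⊥ (≤-trans (s≤s c<p) p<q) q≤s)
arcColour-∘-after (node x l r) t place c p q c<p p<q q≤s with leafSide l c
... | inLeft c<l rewrite ∘-left x l r t c c<l with q ≤? arity l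
...   | yes q≤l =
  trans (arcColour-left x (l ∘[ suc c ] t) r place _ _ (≤arity⇒≤arity-∘ l t c<l q≤l))
    (trans (arcColour-∘-after l t left c p q c<p p<q q≤l) (sym (arcColour-left x l r place p q q≤l)))
...   | no q≰l with arity l ≤? p
...     | yes l≤p with m≤n⇒∃[o]m+o≡n l≤p | m≤n⇒∃[o]m+o≡n (≤-trans l≤p (<⇒≤ p<q))
...       | p′ , refl | q′ , refl =
  trans (arcColour-right′ x (l ∘[ suc c ] t) r place p′ q′ p′<q′ (shift p′) (shift q′))
        (sym (arcColour-right x l r place p′ q′ p′<q′))
  where
  p′<q′ : p′ < q′
  p′<q′ = +-cancelˡ-< (arity l) _ _ p<q
  shift : ∀ z → arity l + z + excess t ≡ arity (l ∘[ suc c ] t) + z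
  shift z = trans (m+n+o≡m+o+n (arity l) z (excess t)) (cong (_+ z) (sym (arity-∘ l t c c<l)))
arcColour-∘-after (node x l r) t place c p q c<p p<q q≤s | inLeft c<l | no q≰l | no l≰p =
  trans (arcColour-cross x (l ∘[ suc c ] t) r place (p + excess t) (q + excess t)
           (<arity⇒<arity-∘ l t c<l (≰⇒> l≰p)) (>arity⇒>arity-∘ l t c<l (≰⇒> q≰l))
           (inj₁ (<-≤-trans (s≤s z≤n) (≤-trans c<p (m≤m+n p (excess t))))))
        (sym (arcColour-cross x l r place p q (≰⇒> l≰p) (≰⇒> q≰l) (inj₁ (<-≤-trans (s≤s z≤n) c<p))))
arcColour-∘-after (node x l r) t place c p q c<p p<q q≤s | inRight c′ rewrite ∘-right x l r t c′
  with m≤n⇒∃[o]m+o≡n (≤-trans (n≤1+n (arity l)) (≤-trans (s≤s (m≤m+n (arity l) c′)) c<p))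
...   | p′ , refl with m≤n⇒∃[o]m+o≡n (≤-trans (m≤m+n (arity l) p′) (<⇒≤ p<q))
...     | q′ , refl =
  trans (arcColour-right′ x l (r ∘[ suc c′ ] t) place (p′ + excess t) (q′ + excess t) (+-monoˡ-< (excess t) p′<q′)
           (+-assoc (arity l) p′ (excess t)) (+-assoc (arity l) q′ (excess t)))
    (trans (arcColour-∘-after r t right c′ p′ q′ (+-cancelˡ-< _ _ _ c<p) p′<q′ (+-cancelˡ-≤ (arity l) _ _ q≤s))
      (sym (arcColour-right x l r place p′ q′ p′<q′)))
  where
  p′<q′ : p′ < q′
  p′<q′ = +-cancelˡ-< (arity l) _ _ p<q

arcColour-∘-over : ∀ s t place c p q → p ≤ c → suc c ≤ q → q ≤ arity s → ¬ (p ≡ c × q ≡ suc c) →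
                   arcColour (s ∘[ suc c ] t) place p (q + excess t) ≡ arcColour s place p q
arcColour-∘-over-nonRoot : ∀ x l r t place c p q → p ≤ c → suc c ≤ q → q ≤ arity l + arity r →
                           ¬ (p ≡ c × q ≡ suc c) → 0 < p ⊎ q < arity l + arity r →
                           arcColour (node x l r ∘[ suc c ] t) place p (q + excess t) ≡ arcColour (node x l r) place p q

arcColour-∘-over leaf t place zero zero (suc zero) _ _ _ ne = ⊥-elim (ne (refl , refl))
arcColour-∘-over leaf t place zero zero zero _ () _ _
arcColour-∘-over leaf t place zero zero (suc (suc q)) _ _ (s≤s ()) _
arcColour-∘-over leaf t place zero (suc p) q () _ _ _
arcColour-∘-over leaf t place (suc c) p q _ c<q q≤1 _ = ⊥-elim (2+m≤n≤1⇒⊥ c<q q≤1)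
arcColour-∘-over (node x l r) t place c p q p≤c c<q q≤N ne with p ≟ 0 | q ≟ arity l + arity r
... | yes refl | yes refl =
  trans (arcColour-root′ (node x l r ∘[ suc c ] t) place (sym (arity-∘ (node x l r) t c c<q)))
    (trans (rootColour-∘ x l r t (suc c) place) (sym (arcColour-root (node x l r) place)))
... | yes refl | no q≢N = arcColour-∘-over-nonRoot x l r t place c p q p≤c c<q q≤N ne (inj₂ (≤∧≢⇒< q≤N q≢N))
... | no p≢0 | _ = arcColour-∘-over-nonRoot x l r t place c p q p≤c c<q q≤N ne (inj₁ (n≢0⇒n>0 p≢0))

arcColour-∘-over-nonRoot x l r t place c p q p≤c c<q q≤N ne nonRoot with leafSide l c
... | inLeft c<l rewrite ∘-left x l r t c c<l with q ≤? arity l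
...   | yes q≤l =
  trans (arcColour-left x (l ∘[ suc c ] t) r place _ _ (≤arity⇒≤arity-∘ l t c<l q≤l))
    (trans (arcColour-∘-over l t left c p q p≤c c<q q≤l ne) (sym (arcColour-left x l r place p q q≤l)))
...   | no q≰l =
  trans (arcColour-cross x (l ∘[ suc c ] t) r place p (q + excess t)
           (<-≤-trans p<l (arity≤arity-∘ l t c<l)) (>arity⇒>arity-∘ l t c<l (≰⇒> q≰l))
           (nonRoot-+ (excess t) N+excess nonRoot))
        (sym (arcColour-cross x l r place p q p<l (≰⇒> q≰l) nonRoot))
  where
  p<l : p < arity l
  p<l = <-≤-trans (s≤s p≤c) c<l
  N+excess : arity l + arity r + excess t ≡ arity (l ∘[ suc c ] t) + arity r
  N+excess = trans (m+n+o≡m+o+n (arity l) (arity r) (excess t)) (cong (_+ arity r) (sym (arity-∘ l t c c<l)))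
arcColour-∘-over-nonRoot x l r t place c p q p≤c c<q q≤N ne nonRoot | inRight c′ rewrite ∘-right x l r t c′
  with m≤n⇒∃[o]m+o≡n (≤-trans (n≤1+n (arity l)) (≤-trans (s≤s (m≤m+n (arity l) c′)) c<q))
...   | q′ , refl with arity l ≤? p
...     | yes l≤p with m≤n⇒∃[o]m+o≡n l≤p
...       | p′ , refl =
  trans (arcColour-right′ x l (r ∘[ suc c′ ] t) place p′ (q′ + excess t) (<-≤-trans p′<q′ (m≤m+n q′ (excess t)))
           refl (+-assoc (arity l) q′ (excess t)))
    (trans (arcColour-∘-over r t right c′ p′ q′ (+-cancelˡ-≤ (arity l) _ _ p≤c) (+-cancelˡ-< _ _ _ c<q)
              (+-cancelˡ-≤ (arity l) _ _ q≤N) ne′)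
      (sym (arcColour-right x l r place p′ q′ p′<q′)))
  where
  p′<q′ : p′ < q′
  p′<q′ = ≤-<-trans (+-cancelˡ-≤ (arity l) _ _ p≤c) (+-cancelˡ-< _ _ _ c<q)
  ne′ : ¬ (p′ ≡ c′ × q′ ≡ suc c′)
  ne′ (e1 , e2) = ne (cong (arity l +_) e1 , trans (cong (arity l +_) e2) (+-suc (arity l) c′))
arcColour-∘-over-nonRoot x l r t place c p q p≤c c<q q≤N ne nonRoot | inRight c′ | q′ , refl | no l≰p =
  trans (arcColour-cross x l (r ∘[ suc c′ ] t) place p (arity l + q′ + excess t) (≰⇒> l≰p)
           (<-≤-trans l<q (m≤m+n (arity l + q′) (excess t))) (nonRoot-+ (excess t) N+excess nonRoot))
        (sym (arcColour-cross x l r place p (arity l + q′) (≰⇒> l≰p) l<q nonRoot))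
  where
  l<q : arity l < arity l + q′
  l<q = <-≤-trans (m<1+[m+n] (arity l) c′) c<q
  N+excess : arity l + arity r + excess t ≡ arity l + arity (r ∘[ suc c′ ] t)
  N+excess = trans (+-assoc (arity l) (arity r) (excess t))
               (cong (arity l +_) (sym (arity-∘ r t c′ (≤-trans (+-cancelˡ-< _ _ _ c<q) (+-cancelˡ-≤ (arity l) _ _ q≤N)))))

arcColour-∘-enter : ∀ s t place c p q → suc c ≤ arity s → p < c → c < q → q < c + arity t →
                    arcColour (s ∘[ suc c ] t) place p q ≡ none
arcColour-∘-enter leaf t place zero p q _ () _ _
arcColour-∘-enter leaf t place (suc c) p q (s≤s ()) _ _ _
arcColour-∘-enter (node x l r) t place c p q c<s p<c c<q q<end with leafSide l c
... | inLeft c<l rewrite ∘-left x l r t c c<l =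
  trans (arcColour-left x (l ∘[ suc c ] t) r place p q (<⇒≤ q<l′)) (arcColour-∘-enter l t left c p q c<l p<c c<q q<end)
  where
  q<l′ : q < arity (l ∘[ suc c ] t)
  q<l′ = <-≤-trans q<end (≤-trans (≤-reflexive (c+arity≡1+c+excess c t)) (≤arity⇒≤arity-∘ l t c<l c<l))
... | inRight c′ rewrite ∘-right x l r t c′ with arity l ≤? p
...   | yes l≤p with m≤n⇒∃[o]m+o≡n l≤p | m≤n⇒∃[o]m+o≡n (≤-trans l≤p (<⇒≤ (<-trans p<c c<q)))
...     | p′ , refl | q′ , refl =
  trans (arcColour-right x l (r ∘[ suc c′ ] t) place p′ q′ (<-trans p′<c′ c′<q′))
        (arcColour-∘-enter r t right c′ p′ q′ (+-cancelˡ-< _ _ _ c<s) p′<c′ c′<q′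
           (+-cancelˡ-< (arity l) _ _ (subst (arity l + q′ <_) (+-assoc (arity l) c′ (arity t)) q<end)))
  where
  p′<c′ : p′ < c′
  p′<c′ = +-cancelˡ-< (arity l) _ _ p<c
  c′<q′ : c′ < q′
  c′<q′ = +-cancelˡ-< (arity l) _ _ c<q
arcColour-∘-enter (node x l r) t place c p q c<s p<c c<q q<end | inRight c′ | no l≰p =
  arcColour-cross x l (r ∘[ suc c′ ] t) place p q (≰⇒> l≰p) (≤-<-trans (m≤m+n (arity l) c′) c<q) (inj₂ q<N)
  where
  q<N : q < arity l + arity (r ∘[ suc c′ ] t)
  q<N = <-≤-trans q<end
          (≤-trans (≤-reflexive (trans (+-assoc (arity l) c′ (arity t)) (cong (arity l +_) (c+arity≡1+c+excess c′ t))))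
            (+-monoʳ-≤ (arity l) (≤arity⇒≤arity-∘ r t c<r c<r)))
    where
    c<r = +-cancelˡ-< _ _ _ c<s

arcColour-∘-exit : ∀ s t place c p q → suc c ≤ arity s → c < p → p < c + arity t → c + arity t < q →
                   q ≤ arity s + excess t → arcColour (s ∘[ suc c ] t) place p q ≡ none
arcColour-∘-exit leaf t place zero p q _ _ _ end<q q≤ =
  ⊥-elim (<⇒≱ end<q (≤-trans q≤ (≤-reflexive (sym (arity≡1+excess t)))))
arcColour-∘-exit leaf t place (suc c) p q (s≤s ()) _ _ _ _
arcColour-∘-exit (node x l r) t place c p q c<s c<p p<end end<q q≤ with leafSide l c
... | inLeft c<l rewrite ∘-left x l r t c c<l with q ≤? arity (l ∘[ suc c ] t)
...   | yes q≤l′ =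
  trans (arcColour-left x (l ∘[ suc c ] t) r place p q q≤l′)
        (arcColour-∘-exit l t left c p q c<l c<p p<end end<q (subst (q ≤_) (arity-∘ l t c c<l) q≤l′))
...   | no q≰l′ = arcColour-cross x (l ∘[ suc c ] t) r place p q p<l′ (≰⇒> q≰l′) (inj₁ (≤-<-trans z≤n c<p))
  where
  p<l′ : p < arity (l ∘[ suc c ] t)
  p<l′ = <-≤-trans p<end (≤-trans (≤-reflexive (c+arity≡1+c+excess c t)) (≤arity⇒≤arity-∘ l t c<l c<l))
arcColour-∘-exit (node x l r) t place c p q c<s c<p p<end end<q q≤ | inRight c′ rewrite ∘-right x l r t c′
  with m≤n⇒∃[o]m+o≡n (<⇒≤ (≤-<-trans (m≤m+n (arity l) c′) c<p))
...   | p′ , refl with m≤n⇒∃[o]m+o≡n (≤-trans (m≤m+n (arity l) p′) (<⇒≤ (<-trans p<end end<q)))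
...     | q′ , refl =
  trans (arcColour-right x l (r ∘[ suc c′ ] t) place p′ q′ (<-trans p′<end′ end′<q′))
    (arcColour-∘-exit r t right c′ p′ q′ (+-cancelˡ-< _ _ _ c<s) (+-cancelˡ-< (arity l) _ _ c<p) p′<end′ end′<q′
       (+-cancelˡ-≤ (arity l) _ _ (subst (arity l + q′ ≤_) (+-assoc (arity l) (arity r) (excess t)) q≤)))
  where
  p′<end′ : p′ < c′ + arity t
  p′<end′ = +-cancelˡ-< (arity l) _ _ (subst (arity l + p′ <_) (+-assoc (arity l) c′ (arity t)) p<end)
  end′<q′ : c′ + arity t < q′
  end′<q′ = +-cancelˡ-< (arity l) _ _ (subst (_< arity l + q′) (+-assoc (arity l) c′ (arity t)) end<q)

arcColour-edge : ∀ s place c → suc c ≤ arity s → arcColour s place c (suc c) ≡ leafColour (leafPlace s (suc c) place)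
arcColour-edge leaf place zero _ = refl
arcColour-edge leaf place (suc c) (s≤s ())
arcColour-edge (node x l r) place c c<s with leafSide l c
... | inLeft c<l rewrite leafPlace-left x l r c place c<l =
  trans (arcColour-left x l r place c (suc c) c<l) (arcColour-edge l left c c<l)
... | inRight c′ rewrite leafPlace-right x l r c′ place =
  trans (arcColour-right′ x l r place c′ (suc c′) (n<1+n c′) refl (sym (+-suc (arity l) c′)))
        (arcColour-edge r right c′ (+-cancelˡ-< _ _ _ c<s))

inI≡true : ∀ {lo hi p} → lo ≤ p → p ≤ hi → inI lo hi p ≡ true
inI≡true h1 h2 rewrite ≤⇒≤ᵇ≡true h1 | ≤⇒≤ᵇ≡true h2 = refl

inI≡false : ∀ {lo hi p} → ¬ (lo ≤ p × p ≤ hi) → inI lo hi p ≡ false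
inI≡false {lo} {hi} {p} ne with lo ≤? p | p ≤? hi
... | yes h1 | yes h2 = ⊥-elim (ne (h1 , h2))
... | yes h1 | no h2 rewrite ≤⇒≤ᵇ≡true h1 | >⇒≤ᵇ≡false (≰⇒> h2) = refl
... | no h1 | _ rewrite >⇒≤ᵇ≡false (≰⇒> h1) = refl

inI∧inI≡false : ∀ {lo hi p q} → ¬ (lo ≤ p × q ≤ hi) → (inI lo hi p ∧ inI lo hi q) ≡ false
inI∧inI≡false {lo} {hi} {p} {q} ne with lo ≤? p
... | no h rewrite inI≡false {lo} {hi} {p} (λ (h′ , _) → h h′) = refl
... | yes h rewrite inI≡false {lo} {hi} {q} (λ (_ , h′) → ne (h , h′)) = ∧-zeroʳ (inI lo hi p)

-- The vertex of C that vertex p of  compose C i D  comes from, when size D = k + 1.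
vertexOfC : ℕ → ℕ → ℕ → ℕ
vertexOfC i k p = if p ≤ᵇ i then p else p ∸ k

vertexOfC-≤ : ∀ i k p → p ≤ i → vertexOfC i k p ≡ p
vertexOfC-≤ i k p h rewrite ≤⇒≤ᵇ≡true h = refl

vertexOfC-≥ : ∀ i k p → i + suc k ≤ p → vertexOfC i k p ≡ p ∸ k
vertexOfC-≥ i k p h rewrite >⇒≤ᵇ≡false {p} {i} (≤-trans (s≤s (m≤m+n i k)) (subst (_≤ p) (+-suc i k) h)) = refl

private
  1+i≤p∸k : ∀ i k p → i + suc k ≤ p → suc i ≤ p ∸ k
  1+i≤p∸k i k p h = m+n≤o⇒m≤o∸n (suc i) (subst (_≤ p) (+-suc i k) h)

Outside : ℕ → ℕ → ℕ → Set
Outside i m p = p ≤ i ⊎ i + m ≤ p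

vertexOfC-mono-< : ∀ i k p q → p < q → Outside i (suc k) p → Outside i (suc k) q →
                   vertexOfC i k p < vertexOfC i k q
vertexOfC-mono-< i k p q hpq (inj₁ hp) (inj₁ hq)
  rewrite vertexOfC-≤ i k p hp | vertexOfC-≤ i k q hq = hpq
vertexOfC-mono-< i k p q hpq (inj₁ hp) (inj₂ hq)
  rewrite vertexOfC-≤ i k p hp | vertexOfC-≥ i k q hq = ≤-trans (s≤s hp) (1+i≤p∸k i k q hq)
vertexOfC-mono-< i k p q hpq (inj₂ hp) (inj₁ hq) =
  ⊥-elim (<⇒≱ (<-≤-trans hpq hq) (≤-trans (m≤m+n i (suc k)) hp))
vertexOfC-mono-< i k p q hpq (inj₂ hp) (inj₂ hq)
  rewrite vertexOfC-≥ i k p hp | vertexOfC-≥ i k q hq =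
  ∸-monoˡ-< hpq (≤-trans (m≤n+m k (suc i)) (subst (_≤ p) (+-suc i k) hp))

1≤vertexOfC : ∀ i k p → 1 ≤ p → Outside i (suc k) p → 1 ≤ vertexOfC i k p
1≤vertexOfC i k p h (inj₁ hp) rewrite vertexOfC-≤ i k p hp = h
1≤vertexOfC i k p h (inj₂ hp) rewrite vertexOfC-≥ i k p hp = ≤-trans (s≤s z≤n) (1+i≤p∸k i k p hp)

vertexOfC≤1+n : ∀ i k n q → i ≤ n → q ≤ n + suc k → Outside i (suc k) q → vertexOfC i k q ≤ suc n
vertexOfC≤1+n i k n q hin hq (inj₁ h) rewrite vertexOfC-≤ i k q h = ≤-trans h (≤-trans hin (n≤1+n n))
vertexOfC≤1+n i k n q hin hq (inj₂ h) rewrite vertexOfC-≥ i k q h =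
  m≤n+o⇒m∸n≤o q k (subst (q ≤_) (trans (+-comm n (suc k)) (sym (+-suc k n))) hq)

data Region (i m p q : ℕ) : Set where
  glued    : p ≡ i → q ≡ i + m → Region i m p q
  insideD  : i ≤ p → q ≤ i + m → ¬ (p ≡ i × q ≡ i + m) → Region i m p q
  insideC  : Outside i m p → Outside i m q → ¬ (i ≤ p × q ≤ i + m) → Region i m p q
  crossing : (i < p × p < i + m) ⊎ (i < q × q < i + m) → ¬ (i ≤ p × q ≤ i + m) → Region i m p q

outside? : ∀ i m p → Outside i m p ⊎ (i < p × p < i + m)
outside? i m p with p ≤? i | i + m ≤? p
... | yes h | _     = inj₁ (inj₁ h)
... | no _  | yes h = inj₁ (inj₂ h)
... | no h1 | no h2 = inj₂ (≰⇒> h1 , ≰⇒> h2)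

region : ∀ i m p q → Region i m p q
region i m p q with i ≤? p ×-dec q ≤? i + m
... | yes (h1 , h2) with p ≟ i | q ≟ i + m
...   | yes e1 | yes e2 = glued e1 e2
...   | yes _  | no ne2 = insideD h1 h2 (λ (_ , e2) → ne2 e2)
...   | no ne1 | _      = insideD h1 h2 (λ (e1 , _) → ne1 e1)
region i m p q | no ne with outside? i m p | outside? i m q
... | inj₁ op | inj₁ oq = insideC op oq ne
... | inj₂ cp | _       = crossing (inj₁ cp) ne
... | inj₁ _  | inj₂ cq = crossing (inj₂ cq) ne

module Composite (C : Config) (i : ℕ) (D : Config) where
  private
    n = size C
    m = size D

  col-glued : col (compose C i D) i (i + m) ≡ glue (col C i (suc i)) (col D 1 (suc m))
  col-glued rewrite ≡⇒≡ᵇ≡true (refl {x = i}) | ≡⇒≡ᵇ≡true (refl {x = i + m}) = refl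

  private
    inC : ℕ → Bool
    inC p = inI 1 i p ∨ inI (i + m) (n + m) p

    inC≡true : ∀ {p} → 1 ≤ p → p ≤ n + m → Outside i m p → inC p ≡ true
    inC≡true h1 h2 (inj₁ h) rewrite inI≡true h1 h = refl
    inC≡true {p} h1 h2 (inj₂ h) rewrite inI≡true h h2 = ∨-zeroʳ (inI 1 i p)

    inC≡false : ∀ {p} → i < p × p < i + m → inC p ≡ false
    inC≡false {p} (h1 , h2)
      rewrite inI≡false {1} {i} {p} (λ (_ , h) → <⇒≱ h1 h)
            | inI≡false {i + m} {n + m} {p} (λ (h , _) → <⇒≱ h2 h) = refl

    inC∧inC≡false : ∀ {p q} → (i < p × p < i + m) ⊎ (i < q × q < i + m) → (inC p ∧ inC q) ≡ false
    inC∧inC≡false (inj₁ cp) rewrite inC≡false cp = refl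
    inC∧inC≡false {p} (inj₂ cq) rewrite inC≡false cq = ∧-zeroʳ (inC p)

    ¬inside⇒¬glued : ∀ {p q} → ¬ (i ≤ p × q ≤ i + m) → ¬ (p ≡ i × q ≡ i + m)
    ¬inside⇒¬glued ne (refl , refl) = ne (≤-refl , ≤-refl)

  col-insideD : ∀ {p q} → p < q → i ≤ p → q ≤ i + m → ¬ (p ≡ i × q ≡ i + m) →
                col (compose C i D) p q ≡ col D (suc (p ∸ i)) (suc (q ∸ i))
  col-insideD {p} {q} hpq h1 h2 ne
    rewrite ≡ᵇ∧≡ᵇ≡false ne
          | inI≡true {i} {i + m} {p} h1 (≤-trans (<⇒≤ hpq) h2)
          | inI≡true {i} {i + m} {q} (≤-trans h1 (<⇒≤ hpq)) h2 = refl

  col-insideC : ∀ {p q} → 1 ≤ p → p < q → q ≤ n + m → Outside i m p → Outside i m q →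
                ¬ (i ≤ p × q ≤ i + m) →
                col (compose C i D) p q ≡ col C (vertexOfC i (m ∸ 1) p) (vertexOfC i (m ∸ 1) q)
  col-insideC {p} {q} h1 hpq h2 op oq ne
    rewrite ≡ᵇ∧≡ᵇ≡false (¬inside⇒¬glued ne)
          | inI∧inI≡false {i} {i + m} {p} {q} ne
          | inC≡true h1 (<⇒≤ (<-≤-trans hpq h2)) op
          | inC≡true (≤-trans h1 (<⇒≤ hpq)) h2 oq = refl

  col-crossing : ∀ {p q} → (i < p × p < i + m) ⊎ (i < q × q < i + m) → ¬ (i ≤ p × q ≤ i + m) →
                 col (compose C i D) p q ≡ none
  col-crossing {p} {q} cr ne
    rewrite ≡ᵇ∧≡ᵇ≡false (¬inside⇒¬glued ne)
          | inI∧inI≡false {i} {i + m} {p} {q} ne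
          | inC∧inC≡false cr = refl

≈-refl : ∀ {C} → C ≈ C
≈-refl = refl , λ _ _ _ _ _ → refl

≈-sym : ∀ {C D} → C ≈ D → D ≈ C
≈-sym (e , h) = sym e , λ i j h1 h2 h3 → sym (h i j h1 h2 (subst (λ z → j ≤ suc z) (sym e) h3))

≈-trans : ∀ {C D E} → C ≈ D → D ≈ E → C ≈ E
≈-trans (e , h) (e′ , h′) =
  trans e e′ , λ i j h1 h2 h3 → trans (h i j h1 h2 h3) (h′ i j h1 h2 (subst (λ z → j ≤ suc z) e h3))

≈-setoid : Setoid 0ℓ 0ℓ
≈-setoid = record
  { Carrier = Config
  ; _≈_ = _≈_
  ; isEquivalence = record { refl = ≈-refl ; sym = ≈-sym ; trans = ≈-trans }
  }

module ≈-Reasoning = SetoidReasoning ≈-setoid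

compose-cong : ∀ {C C′ D D′} i → C ≈ C′ → D ≈ D′ → 1 ≤ i → i ≤ size C → 1 ≤ size D →
               compose C i D ≈ compose C′ i D′
compose-cong {mkConfig n c} {mkConfig .n c′} {mkConfig (suc k) d} {mkConfig .(suc k) d′}
             i (refl , hc) (refl , hd) 1≤i i≤n _ = refl , arcs
  where
  C = mkConfig n c
  C′ = mkConfig n c′
  D = mkConfig (suc k) d
  D′ = mkConfig (suc k) d′
  open Composite
  arcs : ∀ p q → 1 ≤ p → p < q → q ≤ suc (n + suc k ∸ 1) →
         col (compose C i D) p q ≡ col (compose C′ i D′) p q
  arcs p q 1≤p p<q q≤ with region i (suc k) p q
  ... | glued refl refl =
    trans (col-glued C i D)
      (trans (cong₂ glue (hc i (suc i) 1≤i (n<1+n i) (s≤s i≤n))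
                         (hd 1 (suc (suc k)) (s≤s z≤n) (s≤s (s≤s z≤n)) ≤-refl))
        (sym (col-glued C′ i D′)))
  ... | insideD h1 h2 ne =
    trans (col-insideD C i D p<q h1 h2 ne)
      (trans (hd _ _ (s≤s z≤n) (s≤s (∸-monoˡ-< p<q h1)) (s≤s (m≤n+o⇒m∸n≤o q i h2)))
        (sym (col-insideD C′ i D′ p<q h1 h2 ne)))
  ... | insideC op oq ne =
    trans (col-insideC C i D 1≤p p<q q≤n+m op oq ne)
      (trans (hc _ _ (1≤vertexOfC i k p 1≤p op) (vertexOfC-mono-< i k p q p<q op oq) (vertexOfC≤1+n i k n q i≤n q≤n+m oq))
        (sym (col-insideC C′ i D′ 1≤p p<q q≤n+m op oq ne)))
    where
    q≤n+m : q ≤ n + suc k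
    q≤n+m = subst (q ≤_) (m+[n∸m]≡n (≤-trans (s≤s z≤n) (m≤n+m (suc k) n))) q≤
  ... | crossing cr ne = trans (col-crossing C i D cr ne) (sym (col-crossing C′ i D′ cr ne))

config : Tree → Config
config t = mkConfig (arity t) (λ p q → arcColour t top (p ∸ 1) (q ∸ 1))

module GraftedArcs (s t : Tree) (c : ℕ) (c<s : suc c ≤ arity s) where
  private
    d = excess t
    u = s ∘[ suc c ] t

    d≡ : arity t ≡ suc d
    d≡ = arity≡1+excess t

    -- A vertex of the composite to the right of t is  suc c + suc d + w  (1-based);
    -- it is vertex  suc c + w  of s and vertex  suc c + w + d  of u (0-based).
    split-after : ∀ {p} → suc c + arity t ≤ p → Σ ℕ (λ w → suc c + suc d + w ≡ p)
    split-after h = m≤n⇒∃[o]m+o≡n (subst (λ z → suc c + z ≤ _) d≡ h)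

    back-to-s : ∀ w → suc c + suc d + w ∸ d ∸ 1 ≡ suc c + w
    back-to-s w = trans (cong (λ z → z ∸ d ∸ 1) (shuffle c d w)) (cong (_∸ 1) (m+n∸m≡n d (suc (suc c + w))))
      where shuffle : ∀ c d w → suc c + suc d + w ≡ d + suc (suc c + w)
            shuffle = solve-∀

    in-u : ∀ w → suc c + suc d + w ∸ 1 ≡ suc c + w + d
    in-u w = cong (_∸ 1) (shuffle c d w)
      where shuffle : ∀ c d w → suc c + suc d + w ≡ suc (suc c + w + d)
            shuffle = solve-∀

    after≤s : ∀ w → suc c + suc d + w ≤ arity s + arity t → suc c + w ≤ arity s
    after≤s w h = +-cancelʳ-≤ (suc d) _ _ (subst₂ _≤_ (shuffle c d w) (cong (arity s +_) d≡) h)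
      where shuffle : ∀ c d w → suc c + suc d + w ≡ suc c + w + suc d
            shuffle = solve-∀

    over-¬glued : ∀ p w → ¬ (suc c ≤ suc p × suc c + suc d + w ≤ suc c + arity t) →
                  ¬ (p ≡ c × suc c + w ≡ suc c)
    over-¬glued p w nb (refl , e) with +-cancelˡ-≡ (suc c) w 0 (trans e (sym (+-identityʳ (suc c))))
    ... | refl = nb (≤-refl , ≤-reflexive (trans (+-identityʳ (suc c + suc d)) (cong (suc c +_) (sym d≡))))

  glued-arc : glue (arcColour s top c (suc c)) (arcColour t top 0 (arity t)) ≡ arcColour u top c (c + arity t)
  glued-arc = begin
    glue (arcColour s top c (suc c)) (arcColour t top 0 (arity t))
      ≡⟨ cong₂ glue (arcColour-edge s top c c<s) (arcColour-root t top) ⟩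
    glue (leafColour P) (rootColour t top)         ≡⟨ glue-leafColour P t ⟩
    rootColour t P                                 ≡⟨ arcColour-root t P ⟨
    arcColour t P 0 (arity t)                      ≡⟨ arcColour-∘-inner s t top c 0 (arity t) c<s (1≤arity t) ≤-refl ⟨
    arcColour u top (c + 0) (c + arity t)          ≡⟨ cong (λ z → arcColour u top z (c + arity t)) (+-identityʳ c) ⟩
    arcColour u top c (c + arity t)                ∎
    where
    open ≡-Reasoning
    P = leafPlace s (suc c) top

  inner-arc : ∀ p q → p < q → suc c ≤ p → q ≤ suc c + arity t → ¬ (p ≡ suc c × q ≡ suc c + arity t) →
              arcColour t top (p ∸ suc c) (q ∸ suc c) ≡ arcColour u top (p ∸ 1) (q ∸ 1)
  inner-arc p q p<q c<p q≤end ¬inside with m≤n⇒∃[o]m+o≡n c<p | m≤n⇒∃[o]m+o≡n (≤-trans c<p (<⇒≤ p<q))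
  ... | j , refl | k , refl rewrite m+n∸m≡n c j | m+n∸m≡n c k =
    trans (arcColour-place t top (leafPlace s (suc c) top) j k ne j<k k≤t)
          (sym (arcColour-∘-inner s t top c j k c<s j<k k≤t))
    where
    j<k : j < k
    j<k = +-cancelˡ-< (suc c) _ _ p<q
    k≤t : k ≤ arity t
    k≤t = +-cancelˡ-≤ (suc c) _ _ q≤end
    ne : ¬ (j ≡ 0 × k ≡ arity t)
    ne (refl , refl) = ¬inside (+-identityʳ (suc c) , refl)

  outer-arc : ∀ p q → 1 ≤ p → p < q → q ≤ arity s + arity t →
              Outside (suc c) (arity t) p → Outside (suc c) (arity t) q →
              ¬ (suc c ≤ p × q ≤ suc c + arity t) →
              arcColour s top (vertexOfC (suc c) d p ∸ 1) (vertexOfC (suc c) d q ∸ 1) ≡ arcColour u top (p ∸ 1) (q ∸ 1)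
  outer-arc p q 1≤p p<q q≤ (inj₁ p≥) (inj₁ q≥) _
    rewrite vertexOfC-≤ (suc c) d p p≥ | vertexOfC-≤ (suc c) d q q≥ =
    sym (arcColour-∘-before s t top c (p ∸ 1) (q ∸ 1) c<s (∸-monoˡ-< p<q 1≤p) (∸-monoˡ-≤ 1 q≥))
  outer-arc p q 1≤p p<q q≤ (inj₂ p≥) (inj₁ q≥) _ =
    ⊥-elim (<⇒≱ (<-≤-trans p<q q≥) (≤-trans (m≤m+n (suc c) (arity t)) p≥))
  outer-arc zero q () p<q q≤ (inj₁ p≥) (inj₂ q≥) _
  outer-arc (suc p) q 1≤p p<q q≤ (inj₁ p≥) (inj₂ q≥) ¬inside with split-after q≥
  ... | w , refl = begin
    arcColour s top (vertexOfC (suc c) d (suc p) ∸ 1) (vertexOfC (suc c) d (suc c + suc d + w) ∸ 1)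
      ≡⟨ cong₂ (λ x y → arcColour s top (x ∸ 1) (y ∸ 1))
               (vertexOfC-≤ (suc c) d (suc p) p≥)
               (vertexOfC-≥ (suc c) d (suc c + suc d + w) (m≤m+n (suc c + suc d) w)) ⟩
    arcColour s top p (suc c + suc d + w ∸ d ∸ 1)    ≡⟨ cong (arcColour s top p) (back-to-s w) ⟩
    arcColour s top p (suc c + w)
      ≡⟨ arcColour-∘-over s t top c p (suc c + w) (≤-pred p≥) (s≤s (m≤m+n c w)) (after≤s w q≤) (over-¬glued p w ¬inside) ⟨
    arcColour u top p (suc c + w + d)                ≡⟨ cong (arcColour u top p) (in-u w) ⟨
    arcColour u top p (suc c + suc d + w ∸ 1)        ∎
    where open ≡-Reasoning
  outer-arc p q 1≤p p<q q≤ (inj₂ p≥) (inj₂ q≥) _ with split-after p≥ | split-after q≥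
  ... | w1 , refl | w2 , refl = begin
    arcColour s top (vertexOfC (suc c) d p ∸ 1) (vertexOfC (suc c) d q ∸ 1)
      ≡⟨ cong₂ (λ x y → arcColour s top (x ∸ 1) (y ∸ 1))
               (vertexOfC-≥ (suc c) d p (m≤m+n (suc c + suc d) w1))
               (vertexOfC-≥ (suc c) d q (m≤m+n (suc c + suc d) w2)) ⟩
    arcColour s top (p ∸ d ∸ 1) (q ∸ d ∸ 1)          ≡⟨ cong₂ (arcColour s top) (back-to-s w1) (back-to-s w2) ⟩
    arcColour s top (suc c + w1) (suc c + w2)
      ≡⟨ arcColour-∘-after s t top c (suc c + w1) (suc c + w2) (s≤s (m≤m+n c w1))
           (+-monoʳ-< (suc c) (+-cancelˡ-< (suc c + suc d) _ _ p<q)) (after≤s w2 q≤) ⟨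
    arcColour u top (suc c + w1 + d) (suc c + w2 + d) ≡⟨ cong₂ (arcColour u top) (in-u w1) (in-u w2) ⟨
    arcColour u top (p ∸ 1) (q ∸ 1)                  ∎
    where open ≡-Reasoning

  crossing-arc : ∀ p q → 1 ≤ p → p < q → q ≤ arity s + arity t →
                 (suc c < p × p < suc c + arity t) ⊎ (suc c < q × q < suc c + arity t) →
                 ¬ (suc c ≤ p × q ≤ suc c + arity t) → none ≡ arcColour u top (p ∸ 1) (q ∸ 1)
  crossing-arc zero q () _ _ _ _
  crossing-arc (suc p) zero _ () _ _ _
  crossing-arc (suc p) (suc q) _ p<q q≤ (inj₁ (c<p , p<end)) ¬inside with suc q ≤? suc c + arity t
  ... | yes h = ⊥-elim (¬inside (<⇒≤ c<p , h))
  ... | no h = sym (arcColour-∘-exit s t top c p q c<s (≤-pred c<p) (≤-pred p<end) (≤-pred (≰⇒> h))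
                    (≤-pred (subst (suc q ≤_) (trans (cong (arity s +_) d≡) (+-suc (arity s) d)) q≤)))
  crossing-arc (suc p) (suc q) _ p<q q≤ (inj₂ (c<q , q≤end)) ¬inside with suc c ≤? suc p
  ... | yes h = ⊥-elim (¬inside (h , <⇒≤ q≤end))
  ... | no h = sym (arcColour-∘-enter s t top c p q c<s (≤-pred (≰⇒> h)) (≤-pred c<q) (≤-pred q≤end))

config-∘ : ∀ s t i → 1 ≤ i → i ≤ arity s → compose (config s) i (config t) ≈ config (s ∘[ i ] t)
config-∘ s t (suc c) _ c<s = arity-eq , arcs
  where
  open GraftedArcs s t c c<s
  open Composite (config s) (suc c) (config t)
  arity-eq : arity s + arity t ∸ 1 ≡ arity (s ∘[ suc c ] t)
  arity-eq = trans (+-∸-assoc (arity s) (1≤arity t)) (sym (arity-∘ s t c c<s))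
  q≤s+t : ∀ {q} → q ≤ suc (arity s + arity t ∸ 1) → q ≤ arity s + arity t
  q≤s+t {q} = subst (q ≤_) (m+[n∸m]≡n (≤-trans (1≤arity s) (m≤m+n (arity s) (arity t))))
  arcs : ∀ p q → 1 ≤ p → p < q → q ≤ suc (arity s + arity t ∸ 1) →
         col (compose (config s) (suc c) (config t)) p q ≡ arcColour (s ∘[ suc c ] t) top (p ∸ 1) (q ∸ 1)
  arcs p q 1≤p p<q q≤ with region (suc c) (arity t) p q
  ... | glued refl refl = trans col-glued glued-arc
  ... | insideD h1 h2 ne = trans (col-insideD p<q h1 h2 ne) (inner-arc p q p<q h1 h2 ne)
  ... | insideC op oq ne =
    trans (col-insideC 1≤p p<q (q≤s+t q≤) op oq ne) (outer-arc p q 1≤p p<q (q≤s+t q≤) op oq ne)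
  ... | crossing cr ne = trans (col-crossing cr ne) (crossing-arc p q 1≤p p<q (q≤s+t q≤) cr ne)

_==ᶜ_ : Colour → Colour → Bool
blue ==ᶜ blue = true
red  ==ᶜ red  = true
none ==ᶜ none = true
_    ==ᶜ _    = false

==ᶜ⇒≡ : ∀ x y → (x ==ᶜ y) ≡ true → x ≡ y
==ᶜ⇒≡ blue blue _ = refl
==ᶜ⇒≡ red  red  _ = refl
==ᶜ⇒≡ none none _ = refl
==ᶜ⇒≡ blue red  ()
==ᶜ⇒≡ blue none ()
==ᶜ⇒≡ red  blue ()
==ᶜ⇒≡ red  none ()
==ᶜ⇒≡ none blue ()
==ᶜ⇒≡ none red  ()

rowAgrees : (ℕ → ℕ → Colour) → (ℕ → ℕ → Colour) → ℕ → ℕ → ℕ → Bool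
rowAgrees f g i j zero = true
rowAgrees f g i j (suc k) = (f i j ==ᶜ g i j) ∧ rowAgrees f g i (suc j) k

rowAgrees-sound : ∀ f g i j k → rowAgrees f g i j k ≡ true →
                  ∀ j′ → j ≤ j′ → j′ < j + k → f i j′ ≡ g i j′
rowAgrees-sound f g i j zero e j′ h1 h2 = ⊥-elim (<⇒≱ h2 (subst (_≤ j′) (sym (+-identityʳ j)) h1))
rowAgrees-sound f g i j (suc k) e j′ h1 h2 with j ≟ j′
... | yes refl = ==ᶜ⇒≡ _ _ (proj₁ (∧≡true⇒both {f i j ==ᶜ g i j} e))
... | no ne = rowAgrees-sound f g i (suc j) k (proj₂ (∧≡true⇒both {f i j ==ᶜ g i j} e)) j′
                (≤∧≢⇒< h1 ne) (subst (j′ <_) (+-suc j k) h2)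

arcsAgree : (ℕ → ℕ → Colour) → (ℕ → ℕ → Colour) → ℕ → ℕ → ℕ → Bool
arcsAgree f g i zero N = true
arcsAgree f g i (suc k) N = rowAgrees f g i (suc i) (N ∸ i) ∧ arcsAgree f g (suc i) k N

arcsAgree-sound : ∀ f g i k N → arcsAgree f g i k N ≡ true →
                  ∀ i′ j → i ≤ i′ → i′ < i + k → i′ < j → j ≤ N → f i′ j ≡ g i′ j
arcsAgree-sound f g i zero N e i′ j h1 h2 = ⊥-elim (<⇒≱ h2 (subst (_≤ i′) (sym (+-identityʳ i)) h1))
arcsAgree-sound f g i (suc k) N e i′ j h1 h2 h3 h4 with i ≟ i′
... | yes refl =
  rowAgrees-sound f g i (suc i) (N ∸ i) (proj₁ (∧≡true⇒both {rowAgrees f g i (suc i) (N ∸ i)} e)) j h3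
    (s≤s (subst (j ≤_) (sym (m+[n∸m]≡n (≤-trans (<⇒≤ h3) h4))) h4))
... | no ne =
  arcsAgree-sound f g (suc i) k N (proj₂ (∧≡true⇒both {rowAgrees f g i (suc i) (N ∸ i)} e)) i′ j
    (≤∧≢⇒< h1 ne) (subst (i′ <_) (+-suc i k) h2) h3 h4

≈-byComputation : ∀ C D → size C ≡ size D →
                  arcsAgree (col C) (col D) 1 (suc (size C)) (suc (size C)) ≡ true → C ≈ D
≈-byComputation C D e ch =
  e , λ i j h1 h2 h3 → arcsAgree-sound (col C) (col D) 1 (suc (size C)) (suc (size C)) ch i j h1
                         (<-trans (<-≤-trans h2 h3) (n<1+n _)) h2 h3

unitC≈config : unitC ≈ config leaf
unitC≈config = ≈-byComputation unitC (config leaf) refl refl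

πgen≈config : ∀ x → πgen x ≈ config (g x)
πgen≈config α = ≈-byComputation τaab (config (g α)) refl refl
πgen≈config β = ≈-byComputation τabb (config (g β)) refl refl

2≤size-πgen : ∀ x → 2 ≤ size (πgen x)
2≤size-πgen α = ≤-refl
2≤size-πgen β = ≤-refl

1≤size-πgen∘₂ : ∀ x D → 1 ≤ size (compose (πgen x) 2 D)
1≤size-πgen∘₂ α D = s≤s z≤n
1≤size-πgen∘₂ β D = s≤s z≤n

π≈config : ∀ t → π t ≈ config t
π≈config leaf = unitC≈config
π≈config (node x l r) = begin
  compose (compose (πgen x) 2 (π r)) 1 (π l)
    ≈⟨ compose-cong 1 (compose-cong 2 (πgen≈config x) (π≈config r) (s≤s z≤n) (2≤size-πgen x) (1≤size-π r))
                      (π≈config l) (s≤s z≤n) (1≤size-πgen∘₂ x (π r)) (1≤size-π l) ⟩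
  compose (compose (config (g x)) 2 (config r)) 1 (config l)
    ≈⟨ compose-cong 1 (config-∘ (g x) r 2 (s≤s z≤n) (s≤s (s≤s z≤n))) (≈-refl {config l})
                      (s≤s z≤n) (s≤s z≤n) (1≤arity l) ⟩
  compose (config (node x leaf r)) 1 (config l)
    ≈⟨ config-∘ (node x leaf r) l 1 (s≤s z≤n) (s≤s z≤n) ⟩
  config (node x l r) ∎
  where
  open ≈-Reasoning
  1≤size-π : ∀ t → 1 ≤ size (π t)
  1≤size-π t = subst (1 ≤_) (sym (proj₁ (π≈config t))) (1≤arity t)

config-resp-≡F : ∀ {s t} → s ≡F t → config s ≈ config t
config-resp-≡F ≡F-refl = ≈-refl
config-resp-≡F (≡F-sym h) = ≈-sym (config-resp-≡F h)
config-resp-≡F (≡F-trans h h′) = ≈-trans (config-resp-≡F h) (config-resp-≡F h′)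
config-resp-≡F (≡F-comp {s} {s′} {t} {t′} i 1≤i i≤s hs ht) =
  ≈-trans (≈-sym (config-∘ s t i 1≤i i≤s))
   (≈-trans (compose-cong i (config-resp-≡F hs) (config-resp-≡F ht) 1≤i i≤s (1≤arity t))
     (config-∘ s′ t′ i 1≤i (subst (i ≤_) (proj₁ (config-resp-≡F hs)) i≤s)))
config-resp-≡F ≡F-rel1 = ≈-byComputation _ _ refl refl
config-resp-≡F ≡F-rel2 = ≈-byComputation _ _ refl refl

InGen⇒config : ∀ C → InGen C → Σ Tree (λ t → config t ≈ C)
InGen⇒config _ gen-unit = leaf , ≈-sym unitC≈config
InGen⇒config _ gen-aab = g α , ≈-sym (πgen≈config α)
InGen⇒config _ gen-abb = g β , ≈-sym (πgen≈config β)
InGen⇒config _ (gen-comp {C} {D} i 1≤i i≤C gC gD) with InGen⇒config C gC | InGen⇒config D gD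
... | s , s≈C | t , t≈D =
  s ∘[ i ] t , ≈-trans (≈-sym (config-∘ s t i 1≤i i≤s)) (compose-cong i s≈C t≈D 1≤i i≤s (1≤arity t))
  where
  i≤s : i ≤ arity s
  i≤s = subst (i ≤_) (sym (proj₁ s≈C)) i≤C

InGen-π : ∀ t → InGen (π t)
InGen-π leaf = gen-unit
InGen-π (node x l r) =
  gen-comp 1 (s≤s z≤n) (1≤size-πgen∘₂ x (π r))
    (gen-comp 2 (s≤s z≤n) (2≤size-πgen x) (InGen-πgen x) (InGen-π r)) (InGen-π l)
  where
  InGen-πgen : ∀ x → InGen (πgen x)
  InGen-πgen α = gen-aab
  InGen-πgen β = gen-abb

-- Colours that constrain where a subtree can end

rootColour-left≢red : ∀ u → rootColour u left ≢ red
rootColour-left≢red leaf ()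
rootColour-left≢red (node α _ _) ()
rootColour-left≢red (node β _ _) ()

rootColour-right≢blue : ∀ u → rootColour u right ≢ blue
rootColour-right≢blue leaf ()
rootColour-right≢blue (node α _ _) ()
rootColour-right≢blue (node β _ _) ()

arcColour-prefix≢red : ∀ u place j → 0 < j → j < arity u → arcColour u place 0 j ≢ red
arcColour-prefix≢red leaf place j h1 h2 = ⊥-elim (<⇒≱ h2 h1)
arcColour-prefix≢red (node y l r) place j h1 h2 with j ≤? arity l
... | yes hj rewrite arcColour-left y l r place 0 j hj with j ≟ arity l
...   | yes refl rewrite arcColour-root l left = rootColour-left≢red l
...   | no ne = arcColour-prefix≢red l left j h1 (≤∧≢⇒< hj ne)
arcColour-prefix≢red (node y l r) place j h1 h2 | no hj
  rewrite arcColour-cross y l r place 0 j (1≤arity l) (≰⇒> hj) (inj₂ h2) = λ ()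

arcColour-suffix≢blue : ∀ u place i → 0 < i → i < arity u → arcColour u place i (arity u) ≢ blue
arcColour-suffix≢blue leaf place i h1 h2 = ⊥-elim (<⇒≱ h2 h1)
arcColour-suffix≢blue (node y l r) place i h1 h2 with arity l ≤? i
... | yes hi with m≤n⇒∃[o]m+o≡n hi
...   | i′ , refl rewrite arcColour-right y l r place i′ (arity r) (+-cancelˡ-< (arity l) _ _ h2) with i′ ≟ 0
...     | yes refl rewrite arcColour-root r right = rootColour-right≢blue r
...     | no ne = arcColour-suffix≢blue r right i′ (n≢0⇒n>0 ne) (+-cancelˡ-< (arity l) _ _ h2)
arcColour-suffix≢blue (node y l r) place i h1 h2 | no hi
  rewrite arcColour-cross y l r place i (arity l + arity r) (≰⇒> hi) (m<m+n (arity l) (1≤arity r)) (inj₁ h1) = λ ()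

arcColour-firstEdge : ∀ u place → 1 < arity u → arcColour u place 0 1 ≡ blue
arcColour-firstEdge leaf place (s≤s ())
arcColour-firstEdge (node y l r) place h rewrite arcColour-left y l r place 0 1 (1≤arity l) with l
... | leaf = refl
... | node y′ l′ r′ = arcColour-firstEdge (node y′ l′ r′) left (2≤arity-node y′ l′ r′)

node-cong : ∀ x {l l′ r r′} → l ≡F l′ → r ≡F r′ → node x l r ≡F node x l′ r′
node-cong x hl hr =
  ≡F-comp 1 (s≤s z≤n) (s≤s z≤n) (≡F-comp 2 (s≤s z≤n) (s≤s (s≤s z≤n)) (≡F-refl {g x}) hr) hl

≡F-rotate-generators : ∀ x → node x leaf (node α (node β leaf leaf) leaf) ≡F node x (node β leaf (node α leaf leaf)) leaf
≡F-rotate-generators α = ≡F-rel2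
≡F-rotate-generators β = ≡F-rel1

≡F-rotate : ∀ x T₁ T₂ T₃ T₄ →
            node x T₁ (node α (node β T₂ T₃) T₄) ≡F node x (node β T₁ (node α T₂ T₃)) T₄
≡F-rotate x T₁ T₂ T₃ T₄ =
  ≡F-comp 1 ≤-refl (s≤s z≤n)
   (≡F-comp 2 (s≤s z≤n) (s≤s (s≤s z≤n))
     (≡F-comp 3 (s≤s z≤n) (s≤s (s≤s (s≤s z≤n)))
       (≡F-comp 4 (s≤s z≤n) ≤-refl (≡F-rotate-generators x) (≡F-refl {T₄}))
       (≡F-refl {T₃}))
     (≡F-refl {T₂}))
   (≡F-refl {T₁})

Agree : Place → Tree → Tree → Set
Agree place u u′ = ∀ i j → i < j → j ≤ arity u → arcColour u place i j ≡ arcColour u′ place i j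

rootColour-det : ∀ u u′ place → arity u ≡ arity u′ → rootColour u top ≡ rootColour u′ top →
                 rootColour u place ≡ rootColour u′ place
rootColour-det leaf leaf place _ _ = refl
rootColour-det leaf (node y l r) place e _ = ⊥-elim (<⇒≢ (2≤arity-node y l r) e)
rootColour-det (node y l r) leaf place e _ = ⊥-elim (<⇒≢ (2≤arity-node y l r) (sym e))
rootColour-det (node α _ _) (node α _ _) place _ _ = refl
rootColour-det (node β _ _) (node β _ _) place _ _ = refl
rootColour-det (node α _ _) (node β _ _) place _ ()
rootColour-det (node β _ _) (node α _ _) place _ ()

nodeColour-injective : ∀ x y place → nodeColour x place ≡ nodeColour y place → x ≡ y
nodeColour-injective α α _ _ = refl
nodeColour-injective β β _ _ = refl
nodeColour-injective α β top ()
nodeColour-injective α β left ()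
nodeColour-injective α β right ()
nodeColour-injective β α top ()
nodeColour-injective β α left ()
nodeColour-injective β α right ()

Agree-anyPlace : ∀ u u′ → arity u ≡ arity u′ → Agree top u u′ → ∀ place → Agree place u u′
Agree-anyPlace u u′ e ag place i j h1 h2 with i ≟ 0 | j ≟ arity u
... | yes refl | yes refl =
  trans (arcColour-root u place) (trans (rootColour-det u u′ place e root-top) (sym (arcColour-root′ u′ place e)))
  where
  root-top : rootColour u top ≡ rootColour u′ top
  root-top = trans (sym (arcColour-root u top)) (trans (ag 0 (arity u) h1 ≤-refl) (arcColour-root′ u′ top e))
... | yes refl | no ne =
  trans (arcColour-place u place top 0 j (λ (_ , e′) → ne e′) h1 h2)
   (trans (ag 0 j h1 h2) (arcColour-place u′ top place 0 j (λ (_ , e′) → ne (trans e′ (sym e))) h1 (subst (j ≤_) e h2)))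
... | no ne | _ =
  trans (arcColour-place u place top i j (λ (e′ , _) → ne e′) h1 h2)
   (trans (ag i j h1 h2) (arcColour-place u′ top place i j (λ (e′ , _) → ne e′) h1 (subst (j ≤_) e h2)))

≈⇒Agree : ∀ u u′ → config u ≈ config u′ → arity u ≡ arity u′ × Agree top u u′
≈⇒Agree u u′ (e , f) = e , λ i j h1 h2 → f (suc i) (suc j) (s≤s z≤n) (s≤s h1) (s≤s h2)

≡F⇒Agree : ∀ {u u′} → u ≡F u′ → arity u ≡ arity u′ × (∀ place → Agree place u u′)
≡F⇒Agree {u} {u′} h with ≈⇒Agree u u′ (config-resp-≡F h)
... | e , ag = e , Agree-anyPlace u u′ e ag

arity-resp-≡F : ∀ {u u′} → u ≡F u′ → arity u ≡ arity u′
arity-resp-≡F h = proj₁ (≡F⇒Agree h)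

-- Fixing the colouring of  s = node x l r,  any tree with the same colouring
-- can be rotated so that its root splits its leaves where s does, at v = arity l.
module Splitting (x : Gen) (l r : Tree) (place : Place) where
  private
    c : ℕ → ℕ → Colour
    c = arcColour (node x l r) place
    v N : ℕ
    v = arity l
    N = arity l + arity r

    crossing-none : ∀ p q → p < v → v < q → 0 < p ⊎ q < N → c p q ≡ none
    crossing-none = arcColour-cross x l r place

    from-v≢red : ∀ q → v < q → q < N → c v q ≢ red
    from-v≢red q v<q q<N with m≤n⇒∃[o]m+o≡n (<⇒≤ v<q)
    ... | k , refl =
      arcColour-prefix≢red r right k 0<k (+-cancelˡ-< v k (arity r) q<N)
        ∘′ trans (sym (arcColour-right′ x l r place 0 k 0<k (sym (+-identityʳ v)) refl))
      where
      0<k : 0 < k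
      0<k = +-cancelˡ-< v 0 k (subst (_< v + k) (sym (+-identityʳ v)) v<q)

    to-v≢blue : ∀ p → 0 < p → p < v → c p v ≢ blue
    to-v≢blue p 0<p p<v = arcColour-suffix≢blue l left p 0<p p<v ∘′ trans (sym (arcColour-left x l r place p v ≤-refl))

    v+1≡ : v + 1 ≡ suc v
    v+1≡ = trans (+-suc v 0) (cong suc (+-identityʳ v))

    edge-at-v : suc v < N → c v (suc v) ≡ blue
    edge-at-v h =
      trans (arcColour-right′ x l r place 0 1 (s≤s z≤n) (sym (+-identityʳ v)) (sym v+1≡))
            (arcColour-firstEdge r right (+-cancelˡ-< v 1 (arity r) (subst (_< N) (sym v+1≡) h)))

  -- u, hung at the given place with its leftmost vertex at o, has the colours of s there
  record Realises (u : Tree) (place′ : Place) (o : ℕ) : Set where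
    constructor realises
    field
      arcs : ∀ i j → i < j → j ≤ arity u → arcColour u place′ i j ≡ c (o + i) (o + j)
  open Realises

  private
    realises-left : ∀ {y u₁ u₂ place′ o} → Realises (node y u₁ u₂) place′ o → Realises u₁ left o
    realises-left {y} {u₁} {u₂} {place′} ag = realises λ i j i<j j≤ →
      trans (sym (arcColour-left y u₁ u₂ place′ i j j≤)) (arcs ag i j i<j (≤-trans j≤ (m≤m+n (arity u₁) (arity u₂))))

    realises-right : ∀ {y u₁ u₂ place′ o} → Realises (node y u₁ u₂) place′ o → Realises u₂ right (o + arity u₁)
    realises-right {y} {u₁} {u₂} {place′} {o} ag = realises λ i j i<j j≤ →
      trans (sym (arcColour-right y u₁ u₂ place′ i j i<j))
        (trans (arcs ag (arity u₁ + i) (arity u₁ + j) (+-monoʳ-< (arity u₁) i<j) (+-monoʳ-≤ (arity u₁) j≤))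
          (cong₂ c (sym (+-assoc o (arity u₁) i)) (sym (+-assoc o (arity u₁) j))))

    realises-≡F : ∀ {u u′ place′ o} → u ≡F u′ → Realises u place′ o → Realises u′ place′ o
    realises-≡F {place′ = place′} h ag with ≡F⇒Agree h
    ... | e , agree = realises λ i j i<j j≤ →
      trans (sym (agree place′ i j i<j (subst (j ≤_) (sym e) j≤))) (arcs ag i j i<j (subst (j ≤_) (sym e) j≤))

    realises-root : ∀ {u place′ o} → Realises u place′ o → rootColour u place′ ≡ c o (o + arity u)
    realises-root {u} {place′} {o} ag =
      trans (sym (arcColour-root u place′))
        (trans (arcs ag 0 (arity u) (1≤arity u) ≤-refl) (cong (λ z → c z (o + arity u)) (+-identityʳ o)))

    realises-firstEdge : ∀ {u place′ o} → Realises u place′ o → arcColour u place′ 0 1 ≡ c o (suc o)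
    realises-firstEdge {u} {o = o} ag =
      trans (arcs ag 0 1 (s≤s z≤n) (1≤arity u)) (cong₂ c (+-identityʳ o) (trans (+-suc o 0) (cong suc (+-identityʳ o))))

  private
    start<v : ∀ o A {w} → o + arity A ≡ w → o < w
    start<v o A e = subst (o <_) e (m<m+n o (1≤arity A))

    v<end : ∀ o A C {w} → o + arity A ≡ w → w < o + (arity A + arity C)
    v<end o A C e = subst (_< o + (arity A + arity C)) e
                      (subst (o + arity A <_) (+-assoc o (arity A) (arity C)) (m<m+n (o + arity A) (1≤arity C)))

  -- An α root would colour an arc crossing v, C = leaf would leave the edge after v
  -- uncoloured, and a β root of C would make an arc starting at v red.
  left-shape : ∀ y A C o → Realises (node y A C) left o → o + arity A ≡ v → o + arity A + arity C < N →
               y ≡ β × Σ Tree λ B₁ → Σ Tree λ B₂ → C ≡ node α B₁ B₂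
  left-shape α A C o ag eA end<N
    with trans (realises-root ag)
               (crossing-none o _ (start<v o A eA) (v<end o A C eA)
                  (inj₂ (subst (_< N) (+-assoc o (arity A) (arity C)) end<N)))
  ... | ()
  left-shape β A leaf o ag eA end<N
    with trans (realises-firstEdge (realises-right ag))
               (subst (λ w → c w (suc w) ≡ blue) (sym eA)
                  (edge-at-v (subst (λ w → suc w < N) eA
                                (subst (_< N) (trans (+-suc (o + arity A) 0) (cong suc (+-identityʳ _))) end<N))))
  ... | ()
  left-shape β A C@(node β _ _) o ag eA end<N =
    ⊥-elim (subst (λ w → c w (o + arity A + arity C) ≢ red) (sym eA)
              (from-v≢red _ (subst (_< o + arity A + arity C) eA (m<m+n (o + arity A) (1≤arity C))) end<N)
              (sym (realises-root (realises-right ag))))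
  left-shape β A (node α B₁ B₂) o ag eA end<N = refl , B₁ , B₂ , refl

  -- A β root would colour an arc crossing v, and any A not rooted at β would make an
  -- arc ending at v blue.
  right-shape : ∀ y A C o → Realises (node y A C) right o → 0 < o → o + arity A ≡ v →
                y ≡ α × Σ Tree λ A₁ → Σ Tree λ A₂ → A ≡ node β A₁ A₂
  right-shape β A C o ag 0<o eA
    with trans (realises-root ag) (crossing-none o _ (start<v o A eA) (v<end o A C eA) (inj₁ 0<o))
  ... | ()
  right-shape α A@leaf C o ag 0<o eA =
    ⊥-elim (subst (λ w → c o w ≢ blue) (sym eA) (to-v≢blue o 0<o (start<v o A eA))
              (sym (realises-root (realises-left ag))))
  right-shape α A@(node α _ _) C o ag 0<o eA =
    ⊥-elim (subst (λ w → c o w ≢ blue) (sym eA) (to-v≢blue o 0<o (start<v o A eA))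
              (sym (realises-root (realises-left ag))))
  right-shape α (node β A₁ A₂) C o ag 0<o eA = refl , A₁ , A₂ , refl

  SplitAt : Tree → ℕ → Set
  SplitAt u o = Σ Gen λ y → Σ Tree λ A → Σ Tree λ C → (u ≡F node y A C) × (o + arity A ≡ v)

  private
    mid<N : ∀ o u₁ u₂ → o + (arity u₁ + arity u₂) ≤ N → o + arity u₁ < N
    mid<N o u₁ u₂ end≤N = <-≤-trans (+-monoʳ-< o (m<m+n (arity u₁) (1≤arity u₂))) end≤N

  split : ∀ u place′ o → Realises u place′ o → o < v → v < o + arity u → o + arity u ≤ N → SplitAt u o
  split leaf place′ o ag o<v v<end end≤N = ⊥-elim (<⇒≱ v<end (subst (_≤ v) (+-comm 1 o) o<v))
  split (node y u₁ u₂) place′ o ag o<v v<end end≤N with <-cmp (o + arity u₁) v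
  ... | tri≈ _ e _ = y , u₁ , u₂ , ≡F-refl , e
  ... | tri> _ _ v<mid with split u₁ left o (realises-left ag) o<v v<mid (<⇒≤ (mid<N o u₁ u₂ end≤N))
  ...   | y₁ , A , C , u₁≡ , eA
    with left-shape y₁ A C o (realises-≡F u₁≡ (realises-left ag)) eA
           (subst (_< N) (trans (cong (o +_) (arity-resp-≡F u₁≡)) (sym (+-assoc o (arity A) (arity C))))
                  (mid<N o u₁ u₂ end≤N))
  ...     | refl , B₁ , B₂ , refl =
    y , A , node α (node β B₁ B₂) u₂ ,
    ≡F-trans (node-cong y u₁≡ ≡F-refl) (≡F-sym (≡F-rotate y A B₁ B₂ u₂)) , eA
  split (node y u₁ u₂) place′ o ag o<v v<end end≤N | tri< mid<v _ _
    with split u₂ right (o + arity u₁) (realises-right ag) mid<v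
               (subst (v <_) (sym (+-assoc o (arity u₁) (arity u₂))) v<end)
               (subst (_≤ N) (sym (+-assoc o (arity u₁) (arity u₂))) end≤N)
  ... | y₂ , A , C , u₂≡ , eA
    with right-shape y₂ A C (o + arity u₁) (realises-≡F u₂≡ (realises-right ag))
                     (≤-trans (1≤arity u₁) (m≤n+m (arity u₁) o)) eA
  ...   | refl , A₁ , A₂ , refl =
    y , node β u₁ (node α A₁ A₂) , C , ≡F-trans (node-cong y ≡F-refl u₂≡) (≡F-rotate y u₁ A₁ A₂ C) ,
    trans (sym (+-assoc o (arity u₁) (arity A₁ + arity A₂))) eA

Agree-children : ∀ x l r y A C place → arity A ≡ arity l → arity l + arity r ≡ arity A + arity C →
                 Agree place (node x l r) (node y A C) →
                 x ≡ y × Agree left l A × Agree right r C × arity r ≡ arity C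
Agree-children x l r y A C place eA eN ag = x≡y , agree-left , agree-right , eC
  where
  N = arity l + arity r
  x≡y : x ≡ y
  x≡y = nodeColour-injective x y place
          (trans (sym (arcColour-root (node x l r) place))
            (trans (ag 0 N (≤-trans (1≤arity l) (m≤m+n (arity l) (arity r))) ≤-refl)
              (arcColour-root′ (node y A C) place eN)))
  agree-left : Agree left l A
  agree-left i j i<j j≤ =
    trans (sym (arcColour-left x l r place i j j≤))
      (trans (ag i j i<j (≤-trans j≤ (m≤m+n (arity l) (arity r))))
        (arcColour-left y A C place i j (subst (j ≤_) (sym eA) j≤)))
  agree-right : Agree right r C
  agree-right i j i<j j≤ =
    trans (sym (arcColour-right x l r place i j i<j))
      (trans (ag (arity l + i) (arity l + j) (+-monoʳ-< (arity l) i<j) (+-monoʳ-≤ (arity l) j≤))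
        (arcColour-right′ y A C place i j i<j (cong (_+ i) (sym eA)) (cong (_+ j) (sym eA))))
  eC : arity r ≡ arity C
  eC = +-cancelˡ-≡ (arity l) _ _ (trans eN (cong (_+ arity C) eA))

-- Split t where s splits, then recurse on the two pairs of children.
Agree⇒≡F : ∀ s t place → arity s ≡ arity t → Agree place s t → s ≡F t
Agree⇒≡F leaf leaf _ _ _ = ≡F-refl
Agree⇒≡F leaf (node y l r) _ e _ = ⊥-elim (<⇒≢ (2≤arity-node y l r) e)
Agree⇒≡F (node x l r) leaf _ e _ = ⊥-elim (<⇒≢ (2≤arity-node x l r) (sym e))
Agree⇒≡F (node x l r) t place e ag
  with Splitting.split x l r place t place 0 t-realises (1≤arity l)
         (subst (arity l <_) e (m<m+n (arity l) (1≤arity r))) (≤-reflexive (sym e))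
  where
  t-realises : Splitting.Realises x l r place t place 0
  t-realises = Splitting.realises λ i j i<j j≤ → sym (ag i j i<j (subst (j ≤_) (sym e) j≤))
... | y , A , C , t≡ , eA
  with Agree-children x l r y A C place eA (trans e (arity-resp-≡F t≡)) agree
  where
  agree : Agree place (node x l r) (node y A C)
  agree i j i<j j≤ = trans (ag i j i<j j≤) (proj₂ (≡F⇒Agree t≡) place i j i<j (subst (j ≤_) e j≤))
... | refl , agree-left , agree-right , eC =
  ≡F-trans (node-cong x (Agree⇒≡F l A left (sym eA) agree-left) (Agree⇒≡F r C right eC agree-right)) (≡F-sym t≡)

π-injective : ∀ s t → π s ≈ π t → s ≡F t
π-injective s t h with ≈⇒Agree s t (≈-trans (≈-sym (π≈config s)) (≈-trans h (π≈config t)))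
... | e , ag = Agree⇒≡F s t top e ag

π-resp-≡F : ∀ s t → s ≡F t → π s ≈ π t
π-resp-≡F s t h = ≈-trans (π≈config s) (≈-trans (config-resp-≡F h) (≈-sym (π≈config t)))

mainTheorem12 :
    ((t : Tree) → InGen (π t)) ×
    ((C : Config) → InGen C → Σ Tree (λ t → π t ≈ C)) ×
    ((s t : Tree) → (π s ≈ π t) ⇔ (s ≡F t))
mainTheorem12 =
  InGen-π ,
  (λ C gC → let (t , t≈C) = InGen⇒config C gC in t , ≈-trans (π≈config t) t≈C) ,
  (λ s t → mk⇔ (π-injective s t) (π-resp-≡F s t))
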